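{- Let $(I,s,B,k)$ be an instance of Exact Bin Packing. Let $T$ be the tree with vertex set $\{r\}\cup\{v^i,v^i_1,\ldots,v^i_{s(i)-1} : i\in I\}$ and edge set $\{\{v^i,v^i_j\}: i\in I, 1\le j\le s(i)-1\}\cup\{\{r,v^i\}: i\in I\}$. Then $(I,s,B,k)$ is a yes-instance of Exact Bin Packing if and only if $(T,r,k,2B)$ is a yes-instance of CGE, i.e., there exist $k$ $r$-robot cycles in $T$ whose edge multisets together contain every edge of $T$ and each of length at most $2B$.
   Context: Exact Bin Packing: given a finite set $I$ of items, sizes $s(i)\in\mathbb{N}$, positive integers $B$ and $k$ with $\sum_{i\in I}s(i)=B\cdot k$, decide whether $I$ can be partitioned into disjoint sets $I_1,\ldots,I_k$ with $\sum_{i\in I_j}s(i)=B$ for each $j$. In a graph, an $r$-robot cycle is a sequence $(v_0,\ldots,v_\ell)$ of vertices with consecutive vertices adjacent (repetitions allowed) and $v_0=v_\ell=r$; its length is $\ell$ and its edge multiset consists of the edges $\{v_i,v_{i+1}\}$, $0\le i\le\ell-1$. -}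

module Defs where

open import Data.Nat using (ℕ; zero; suc; _+_; _*_; _∸_; _≤_)
open import Data.Fin using (Fin; _≟_)
open import Data.List using (List; []; _∷_; length; map; filter; allFin; last)
open import Data.Nat.ListAction using (sum)
open import Data.List.Membership.Propositional using (_∈_)
open import Data.List.Relation.Unary.All using (All)
open import Data.Maybe using (just)
open import Data.Product using (_×_; _,_; Σ; ∃)
open import Data.Sum using (_⊎_)
open import Relation.Binary.PropositionalEquality using (_≡_)

binLoad : ∀ {n k} (s : Fin n → ℕ) (f : Fin n → Fin k) (j : Fin k) → ℕ
binLoad {n} s f j = sum (map s (filter (λ i → f i ≟ j) (allFin n)))

ExactBinPackingYes : (n : ℕ) (s : Fin n → ℕ) (B k : ℕ) → Set
ExactBinPackingYes n s B k =
  Σ (Fin n → Fin k) λ f → ∀ (j : Fin k) → binLoad s f j ≡ B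

-- The tree T: vertices r, v^i, v^i_j (1 ≤ j ≤ s(i)-1, indexed by Fin (s i ∸ 1)).
data Vtx (n : ℕ) (s : Fin n → ℕ) : Set where
  root : Vtx n s
  hub  : Fin n → Vtx n s
  leaf : (i : Fin n) → Fin (s i ∸ 1) → Vtx n s

data Edge (n : ℕ) (s : Fin n → ℕ) : Set where
  rootEdge : Fin n → Edge n s
  leafEdge : (i : Fin n) → Fin (s i ∸ 1) → Edge n s

ends : ∀ {n s} → Edge n s → Vtx n s × Vtx n s
ends (rootEdge i)   = root , hub i
ends (leafEdge i j) = hub i , leaf i j

IsEdge : ∀ {n s} → Edge n s → Vtx n s → Vtx n s → Set
IsEdge e u v = ends e ≡ (u , v) ⊎ ends e ≡ (v , u)

Adj : ∀ {n s} → Vtx n s → Vtx n s → Set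
Adj u v = ∃ λ e → IsEdge e u v

steps : ∀ {A : Set} → A → List A → List (A × A)
steps x []       = []
steps x (y ∷ ys) = (x , y) ∷ steps y ys

-- An r-robot cycle (v_0, ..., v_ℓ) is represented by the list (v_1, ..., v_ℓ);
-- v_0 = r implicitly. Its length is ℓ = length of the list.
IsRobotCycle : ∀ {n s} → List (Vtx n s) → Set
IsRobotCycle {n} {s} vs =
  All (λ p → Adj (Data.Product.proj₁ p) (Data.Product.proj₂ p)) (steps root vs)
  × last (root ∷ vs) ≡ just root

cycleLength : ∀ {n s} → List (Vtx n s) → ℕ
cycleLength vs = length vs

EdgeInCycle : ∀ {n s} → Edge n s → List (Vtx n s) → Set
EdgeInCycle {n} {s} e vs =
  ∃ λ p → p ∈ steps root vs × IsEdge e (Data.Product.proj₁ p) (Data.Product.proj₂ p)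

CGEYes : (n : ℕ) (s : Fin n → ℕ) (k L : ℕ) → Set
CGEYes n s k L =
  Σ (Fin k → List (Vtx n s)) λ C →
    (∀ j → IsRobotCycle (C j)) ×
    (∀ j → cycleLength (C j) ≤ L) ×
    (∀ (e : Edge n s) → ∃ λ j → EdgeInCycle e (C j))

totalSize : (n : ℕ) → (Fin n → ℕ) → ℕ
totalSize n s = sum (map s (allFin n))

-- A cycle can only reach a leaf of item i through the hub vᶦ, and every visit
-- of vᶦ costs two steps. Counting visits of hubs in each cycle therefore
-- bounds, per cycle j, the total weight  (number of leaf edges of i charged to
-- j) + [j visits vᶦ]  over all items by B. Summed over the k cycles this weight
-- is at least Σ s(i) = Bk, so every inequality is tight: each hub is visited by
-- exactly one cycle, which then carries the whole star of its item, and the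
-- cycles induce an exact bin packing. Conversely, a packing yields the cycles
-- that walk the stars of each bin in turn.
module Submission where

open import Defs
open import Data.Bool using (true; false; if_then_else_)
open import Data.Empty using (⊥-elim)
open import Data.Fin using (Fin; zero; suc; _≟_)
open import Data.List using (List; []; _∷_; _++_; length; map; filter; allFin; tabulate; last; concatMap)
open import Data.List.Membership.Propositional using (_∈_)
open import Data.List.Membership.Propositional.Properties using (∈-map⁺; ∈-++⁺ˡ; ∈-++⁺ʳ; ∈-filter⁺; ∈-allFin)
open import Data.List.Properties using (length-++; length-map; length-tabulate; map-∘; map-cong; map-tabulate)
open import Data.List.Relation.Unary.All using (All; []; _∷_)
open import Data.List.Relation.Unary.All.Properties using (++⁺)
open import Data.List.Relation.Unary.Any using (here; there)
open import Data.Maybe using (just)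
open import Data.Nat using (ℕ; zero; suc; _+_; _*_; _∸_; _⊓_; _≤_; z≤n; s≤s)
open import Data.Nat.ListAction using (sum)
open import Data.Nat.Properties hiding (_≟_)
open import Algebra.Properties.CommutativeMonoid.Sum +-0-commutativeMonoid
  using (sum-syntax; ∑-distrib-+; ∑-comm; sum-cong-≗; sum-replicate-zero)
  renaming (sum to ∑)
open import Data.Product using (_×_; _,_; proj₁; proj₂; ∃)
open import Data.Sum using (inj₁; inj₂)
open import Function.Base using (id; _∘_)
open import Function.Bundles using (_⇔_; mk⇔)
open import Relation.Nullary using (Dec; yes; no; does; ¬_)
open import Relation.Unary using (Decidable)
open import Relation.Binary.PropositionalEquality

when : ∀ {p} {P : Set p} → Dec P → ℕ → ℕ
when d x = if does d then x else 0

when-holds : ∀ {p} {P : Set p} (d : Dec P) {x} → P → when d x ≡ x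
when-holds (yes _) _ = refl
when-holds (no ¬p) p = ⊥-elim (¬p p)

when-fails : ∀ {p} {P : Set p} (d : Dec P) {x} → ¬ P → when d x ≡ 0
when-fails (yes p) ¬p = ⊥-elim (¬p p)
when-fails (no _)  _  = refl

∑-mono-≤ : ∀ {n} {f g : Fin n → ℕ} → (∀ i → f i ≤ g i) → ∑ f ≤ ∑ g
∑-mono-≤ {zero}  _   = z≤n
∑-mono-≤ {suc n} f≤g = +-mono-≤ (f≤g zero) (∑-mono-≤ (f≤g ∘ suc))

≤-∑ : ∀ {n} (f : Fin n → ℕ) i → f i ≤ ∑ f
≤-∑ f zero    = m≤m+n (f zero) _
≤-∑ f (suc i) = ≤-trans (≤-∑ (f ∘ suc) i) (m≤n+m _ (f zero))

∑-tight : ∀ {n} {f g : Fin n → ℕ} → (∀ i → f i ≤ g i) → ∑ g ≤ ∑ f → ∀ i → f i ≡ g i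
∑-tight {suc n} {f} {g} f≤g ∑g≤∑f zero =
  ≤-antisym (f≤g zero)
    (+-cancelʳ-≤ (∑ (g ∘ suc)) (g zero) (f zero)
      (≤-trans ∑g≤∑f (+-monoʳ-≤ (f zero) (∑-mono-≤ (f≤g ∘ suc)))))
∑-tight {suc n} {f} {g} f≤g ∑g≤∑f (suc i) =
  ∑-tight (f≤g ∘ suc)
    (+-cancelˡ-≤ (g zero) _ _ (≤-trans ∑g≤∑f (+-monoˡ-≤ (∑ (f ∘ suc)) (f≤g zero))))
    i

∑-const : ∀ n c → ∑[ i < n ] c ≡ n * c
∑-const zero    c = refl
∑-const (suc n) c = cong (c +_) (∑-const n c)

∑-when-≟ : ∀ {n} (x : Fin n) v → ∑[ j < n ] when (x ≟ j) v ≡ v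
∑-when-≟ {suc n} zero    v = trans (cong (v +_) (sum-replicate-zero n)) (+-identityʳ v)
∑-when-≟         (suc x) v = ∑-when-≟ x v

∑-single : ∀ {n} (f : Fin n → ℕ) x → (∀ j → j ≢ x → f j ≡ 0) → ∑ f ≡ f x
∑-single f x vanish = trans (sum-cong-≗ concentrated) (∑-when-≟ x (f x))
  where
  concentrated : ∀ j → f j ≡ when (x ≟ j) (f x)
  concentrated j with x ≟ j
  ... | yes refl = refl
  ... | no x≢j   = vanish j (x≢j ∘ sym)

∑-sum-map : ∀ {a} {A : Set a} {n} (F : Fin n → A → ℕ) (xs : List A) →
  ∑[ i < n ] sum (map (F i) xs) ≡ sum (map (λ x → ∑[ i < n ] F i x) xs)
∑-sum-map {n = n} F []       = sum-replicate-zero n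
∑-sum-map         F (x ∷ xs) =
  trans (∑-distrib-+ (λ i → F i x) (λ i → sum (map (F i) xs)))
        (cong (∑ (λ i → F i x) +_) (∑-sum-map F xs))

sum-tabulate : ∀ {n} (f : Fin n → ℕ) → sum (tabulate f) ≡ ∑ f
sum-tabulate {zero}  f = refl
sum-tabulate {suc n} f = cong (f zero +_) (sum-tabulate (f ∘ suc))

sum-map-allFin : ∀ {n} (f : Fin n → ℕ) → sum (map f (allFin n)) ≡ ∑ f
sum-map-allFin f = trans (cong sum (map-tabulate id f)) (sum-tabulate f)

sum-map-filter : ∀ {a p} {A : Set a} {P : A → Set p} (P? : Decidable P) (f : A → ℕ) xs →
  sum (map f (filter P? xs)) ≡ sum (map (λ x → when (P? x) (f x)) xs)
sum-map-filter P? f []       = refl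
sum-map-filter P? f (x ∷ xs) with does (P? x)
... | true  = cong (f x +_) (sum-map-filter P? f xs)
... | false = sum-map-filter P? f xs

∈⇒≤sum : ∀ {a} {A : Set a} (f : A → ℕ) {x xs} → x ∈ xs → f x ≤ sum (map f xs)
∈⇒≤sum f (here refl) = m≤m+n _ _
∈⇒≤sum f (there x∈)  = ≤-trans (∈⇒≤sum f x∈) (m≤n+m _ _)

totalSize≡∑ : ∀ n (s : Fin n → ℕ) → totalSize n s ≡ ∑ s
totalSize≡∑ n s = sum-map-allFin s

binLoad≡∑ : ∀ {n k} (s : Fin n → ℕ) (f : Fin n → Fin k) j →
  binLoad s f j ≡ ∑[ i < n ] when (f i ≟ j) (s i)
binLoad≡∑ {n} s f j =
  trans (sum-map-filter (λ i → f i ≟ j) s (allFin n)) (sum-map-allFin (λ i → when (f i ≟ j) (s i)))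

-- Seen from one item i, the tree T collapses to the path  leaf — hub — elsewhere
-- with a loop at elsewhere (root, other stars); robot cycles become Tours.
data Role : Set where
  atLeaf atHub elsewhere : Role

infix 4 _⟶_
data _⟶_ : Role → Role → Set where
  leaf⟶hub  : atLeaf ⟶ atHub
  hub⟶leaf  : atHub ⟶ atLeaf
  hub⟶else  : atHub ⟶ elsewhere
  else⟶hub  : elsewhere ⟶ atHub
  else⟶else : elsewhere ⟶ elsewhere

data Tour : Role → List Role → Set where
  []  : Tour elsewhere []
  _∷_ : ∀ {a b bs} → a ⟶ b → Tour b bs → Tour a (b ∷ bs)

hubWeight : Role → ℕ
hubWeight atHub = 1
hubWeight _     = 0

leafWeight : Role → ℕ
leafWeight atLeaf = 1
leafWeight _      = 0

#hubs : List Role → ℕ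
#hubs = sum ∘ map hubWeight

#leaves : List Role → ℕ
#leaves = sum ∘ map leafWeight

double-suc-≤ : ∀ {h m} → suc (2 * h) ≤ m → 2 * suc h ≤ suc m
double-suc-≤ {h} le = s≤s (≤-trans (≤-reflexive (+-suc h (h + 0))) le)

hubs-bound : ∀ {a rs} → Tour a rs → hubWeight a + 2 * #hubs rs ≤ length rs
hubs-bound []              = z≤n
hubs-bound (leaf⟶hub  ∷ t)   = double-suc-≤ (hubs-bound t)
hubs-bound (else⟶hub  ∷ t)   = double-suc-≤ (hubs-bound t)
hubs-bound (hub⟶leaf  ∷ t)   = s≤s (hubs-bound t)
hubs-bound (hub⟶else  ∷ t)   = s≤s (hubs-bound t)
hubs-bound (else⟶else ∷ t)   = m≤n⇒m≤1+n (hubs-bound t)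

LeafBound : Role → ℕ → ℕ → Set
LeafBound atLeaf    hubs leaves = suc leaves ≤ hubs
LeafBound atHub     hubs leaves = leaves ≤ hubs
LeafBound elsewhere hubs leaves = leaves + 1 ⊓ hubs ≤ hubs

leaves-bound : ∀ {a rs} → Tour a rs → LeafBound a (#hubs rs) (#leaves rs)
leaves-bound []              = z≤n
leaves-bound (leaf⟶hub  ∷ t)   = s≤s (leaves-bound t)
leaves-bound (_∷_ {bs = bs} else⟶hub t) =
  subst (_≤ suc (#hubs bs)) (+-comm 1 (#leaves bs)) (s≤s (leaves-bound t))
leaves-bound (hub⟶leaf  ∷ t)   = leaves-bound t
leaves-bound (hub⟶else  ∷ t)   = ≤-trans (m≤m+n _ _) (leaves-bound t)
leaves-bound (else⟶else ∷ t)   = leaves-bound t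

module _ {n : ℕ} {s : Fin n → ℕ} where

  private
    V : Set
    V = Vtx n s

  AdjPair : V × V → Set
  AdjPair p = Adj (proj₁ p) (proj₂ p)

  Walk : V → V → List V → Set
  Walk x y vs = All AdjPair (steps x vs) × last (x ∷ vs) ≡ just y

  roleIf : ∀ {p} {P : Set p} → Dec P → Role → Role
  roleIf d r = if does d then r else elsewhere

  role : Fin n → V → Role
  role i root        = elsewhere
  role i (hub i')    = roleIf (i' ≟ i) atHub
  role i (leaf i' _) = roleIf (i' ≟ i) atLeaf

  kind : V → Role
  kind root       = elsewhere
  kind (hub _)    = atHub
  kind (leaf _ _) = atLeaf

  role-⟶ : ∀ i {u v} → Adj u v → role i u ⟶ role i v
  role-⟶ i (rootEdge i' , inj₁ refl) with i' ≟ i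
  ... | yes _ = else⟶hub
  ... | no _  = else⟶else
  role-⟶ i (rootEdge i' , inj₂ refl) with i' ≟ i
  ... | yes _ = hub⟶else
  ... | no _  = else⟶else
  role-⟶ i (leafEdge i' _ , inj₁ refl) with i' ≟ i
  ... | yes _ = hub⟶leaf
  ... | no _  = else⟶else
  role-⟶ i (leafEdge i' _ , inj₂ refl) with i' ≟ i
  ... | yes _ = leaf⟶hub
  ... | no _  = else⟶else

  kind-⟶ : ∀ {u v} → Adj u v → kind u ⟶ kind v
  kind-⟶ (rootEdge _ , inj₁ refl)   = else⟶hub
  kind-⟶ (rootEdge _ , inj₂ refl)   = hub⟶else
  kind-⟶ (leafEdge _ _ , inj₁ refl) = hub⟶leaf
  kind-⟶ (leafEdge _ _ , inj₂ refl) = leaf⟶hub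

  walk⇒tour : (κ : V → Role) → (∀ {u v} → Adj u v → κ u ⟶ κ v) → κ root ≡ elsewhere →
    ∀ {x} vs → Walk x root vs → Tour (κ x) (map κ vs)
  walk⇒tour κ κ-⟶ κ-root []       (_ , refl)      = subst (λ a → Tour a []) (sym κ-root) []
  walk⇒tour κ κ-⟶ κ-root (_ ∷ vs) (uv ∷ uvs , end) = κ-⟶ uv ∷ walk⇒tour κ κ-⟶ κ-root vs (uvs , end)

  hubVisits : Fin n → List V → ℕ
  hubVisits i vs = #hubs (map (role i) vs)

  leafVisits : Fin n → List V → ℕ
  leafVisits i vs = #leaves (map (role i) vs)

  leafVisits+touched≤hubVisits : ∀ i {vs} → IsRobotCycle vs →
    leafVisits i vs + 1 ⊓ hubVisits i vs ≤ hubVisits i vs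
  leafVisits+touched≤hubVisits i {vs} cycle = leaves-bound (walk⇒tour (role i) (role-⟶ i) refl vs cycle)

  hubWeight-role : ∀ v → ∑[ i < n ] hubWeight (role i v) ≡ hubWeight (kind v)
  hubWeight-role root       = sum-replicate-zero n
  hubWeight-role (hub i')   = trans (sum-cong-≗ pointwise) (∑-when-≟ i' 1)
    where
    pointwise : ∀ i → hubWeight (roleIf (i' ≟ i) atHub) ≡ when (i' ≟ i) 1
    pointwise i with i' ≟ i
    ... | yes _ = refl
    ... | no _  = refl
  hubWeight-role (leaf i' _) = trans (sum-cong-≗ pointwise) (sum-replicate-zero n)
    where
    pointwise : ∀ i → hubWeight (roleIf (i' ≟ i) atLeaf) ≡ 0
    pointwise i with i' ≟ i
    ... | yes _ = refl
    ... | no _  = refl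

  2*∑hubVisits≤length : ∀ {vs} → IsRobotCycle vs → 2 * ∑[ i < n ] hubVisits i vs ≤ length vs
  2*∑hubVisits≤length {vs} cycle = begin
    2 * ∑[ i < n ] hubVisits i vs                   ≡⟨ cong (2 *_) (sum-cong-≗ (λ i → cong sum (map-∘ {g = hubWeight} {f = role i} vs))) ⟨
    2 * ∑[ i < n ] sum (map (hubWeight ∘ role i) vs) ≡⟨ cong (2 *_) (∑-sum-map (λ i → hubWeight ∘ role i) vs) ⟩
    2 * sum (map (λ v → ∑[ i < n ] hubWeight (role i v)) vs)
                                                    ≡⟨ cong (λ w → 2 * sum w) (map-cong hubWeight-role vs) ⟩
    2 * sum (map (hubWeight ∘ kind) vs)             ≡⟨ cong (λ w → 2 * sum w) (map-∘ {g = hubWeight} {f = kind} vs) ⟩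
    2 * #hubs (map kind vs)                         ≤⟨ hubs-bound (walk⇒tour kind kind-⟶ refl vs cycle) ⟩
    length (map kind vs)                            ≡⟨ length-map kind vs ⟩
    length vs                                       ∎
    where open ≤-Reasoning

  leafIndicator : (i : Fin n) → Fin (s i ∸ 1) → V → ℕ
  leafIndicator i l (leaf i' l') with i' ≟ i
  ... | yes refl = when (l' ≟ l) 1
  ... | no _     = 0
  leafIndicator i l _ = 0

  occurrences : (i : Fin n) → Fin (s i ∸ 1) → List V → ℕ
  occurrences i l vs = sum (map (leafIndicator i l) vs)

  leafIndicator-role : ∀ i v → ∑[ l < s i ∸ 1 ] leafIndicator i l v ≡ leafWeight (role i v)
  leafIndicator-role i root     = sum-replicate-zero (s i ∸ 1)
  leafIndicator-role i (hub i') = trans (sum-replicate-zero (s i ∸ 1)) (hubIsNoLeaf (i' ≟ i))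
    where
    hubIsNoLeaf : ∀ {p} {P : Set p} (d : Dec P) → 0 ≡ leafWeight (roleIf d atHub)
    hubIsNoLeaf (yes _) = refl
    hubIsNoLeaf (no _)  = refl
  leafIndicator-role i (leaf i' l') with i' ≟ i
  ... | yes refl = ∑-when-≟ l' 1
  ... | no _     = sum-replicate-zero (s i ∸ 1)

  ∑occurrences≡leafVisits : ∀ i vs → ∑[ l < s i ∸ 1 ] occurrences i l vs ≡ leafVisits i vs
  ∑occurrences≡leafVisits i vs = begin
    ∑[ l < s i ∸ 1 ] occurrences i l vs                   ≡⟨ ∑-sum-map (leafIndicator i) vs ⟩
    sum (map (λ v → ∑[ l < s i ∸ 1 ] leafIndicator i l v) vs) ≡⟨ cong sum (map-cong (leafIndicator-role i) vs) ⟩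
    sum (map (leafWeight ∘ role i) vs)                    ≡⟨ cong sum (map-∘ {g = leafWeight} {f = role i} vs) ⟩
    leafVisits i vs                                       ∎
    where open ≡-Reasoning

  hub∈⇒1≤hubVisits : ∀ {i vs} → hub i ∈ vs → 1 ≤ hubVisits i vs
  hub∈⇒1≤hubVisits {i} {vs} hub∈ =
    subst (_≤ hubVisits i vs) (cong hubWeight (selfRole (i ≟ i))) (∈⇒≤sum hubWeight (∈-map⁺ (role i) hub∈))
    where
    selfRole : (d : Dec (i ≡ i)) → roleIf d atHub ≡ atHub
    selfRole (yes _) = refl
    selfRole (no ¬p) = ⊥-elim (¬p refl)

  leaf∈⇒1≤occurrences : ∀ {i l vs} → leaf i l ∈ vs → 1 ≤ occurrences i l vs
  leaf∈⇒1≤occurrences {i} {l} {vs} leaf∈ = subst (_≤ occurrences i l vs) self (∈⇒≤sum (leafIndicator i l) leaf∈)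
    where
    self : leafIndicator i l (leaf i l) ≡ 1
    self with i ≟ i
    ... | yes refl = when-holds (l ≟ l) refl
    ... | no ¬p    = ⊥-elim (¬p refl)

  steps-snd∈ : ∀ {x : V} {vs u v} → (u , v) ∈ steps x vs → v ∈ vs
  steps-snd∈ {vs = _ ∷ _} (here refl) = here refl
  steps-snd∈ {vs = _ ∷ _} (there uv∈) = there (steps-snd∈ uv∈)

  steps-fst∈ : ∀ {x : V} {vs u v} → (u , v) ∈ steps x vs → u ∈ x ∷ vs
  steps-fst∈ {vs = _ ∷ _} (here refl) = here refl
  steps-fst∈ {vs = _ ∷ _} (there uv∈) = there (steps-fst∈ uv∈)

  -- The far end of an edge is never the root, so it is one of v₁ … v_ℓ.
  far-end∈ : ∀ {e : Edge n s} {vs} → EdgeInCycle e vs → proj₂ (ends e) ∈ vs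
  far-end∈ {rootEdge _}   (_ , uv∈ , inj₁ refl) = steps-snd∈ uv∈
  far-end∈ {leafEdge _ _} (_ , uv∈ , inj₁ refl) = steps-snd∈ uv∈
  far-end∈ {rootEdge _} (_ , uv∈ , inj₂ refl) with steps-fst∈ uv∈
  ... | there v∈ = v∈
  far-end∈ {leafEdge _ _} (_ , uv∈ , inj₂ refl) with steps-fst∈ uv∈
  ... | there v∈ = v∈

  steps-++ : ∀ {x y : V} xs ys → last (x ∷ xs) ≡ just y → steps x (xs ++ ys) ≡ steps x xs ++ steps y ys
  steps-++ []       ys refl = refl
  steps-++ (_ ∷ xs) ys end  = cong (_ ∷_) (steps-++ xs ys end)

  last-++ : ∀ {x y z : V} xs ys → last (x ∷ xs) ≡ just y → last (y ∷ ys) ≡ just z → last (x ∷ xs ++ ys) ≡ just z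
  last-++ []       ys refl end₂ = end₂
  last-++ (_ ∷ xs) ys end₁ end₂ = last-++ xs ys end₁ end₂

  walk-++ : ∀ {x y z} xs ys → Walk x y xs → Walk y z ys → Walk x z (xs ++ ys)
  walk-++ xs ys (adj₁ , end₁) (adj₂ , end₂) =
    subst (All AdjPair) (sym (steps-++ xs ys end₁)) (++⁺ adj₁ adj₂) , last-++ xs ys end₁ end₂

  ∈-steps-++ˡ : ∀ {x y p} xs ys → last (x ∷ xs) ≡ just y → p ∈ steps x xs → p ∈ steps x (xs ++ ys)
  ∈-steps-++ˡ xs ys end p∈ = subst (_ ∈_) (sym (steps-++ xs ys end)) (∈-++⁺ˡ p∈)

  ∈-steps-++ʳ : ∀ {x y p} xs ys → last (x ∷ xs) ≡ just y → p ∈ steps y ys → p ∈ steps x (xs ++ ys)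
  ∈-steps-++ʳ {x} xs ys end p∈ = subst (_ ∈_) (sym (steps-++ xs ys end)) (∈-++⁺ʳ (steps x xs) p∈)

  leafLoops : (i : Fin n) → List (Fin (s i ∸ 1)) → List V
  leafLoops i = concatMap (λ l → leaf i l ∷ hub i ∷ [])

  leafLoops-walk : ∀ i ls → Walk (hub i) (hub i) (leafLoops i ls)
  leafLoops-walk i []       = [] , refl
  leafLoops-walk i (l ∷ ls) with leafLoops-walk i ls
  ... | adj , end = (leafEdge i l , inj₁ refl) ∷ (leafEdge i l , inj₂ refl) ∷ adj , end

  length-leafLoops : ∀ i ls → length (leafLoops i ls) ≡ 2 * length ls
  length-leafLoops i []       = refl
  length-leafLoops i (l ∷ ls) = trans (cong (2 +_) (length-leafLoops i ls)) (sym (*-suc 2 (length ls)))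

  ∈-leafLoops : ∀ {i l ls} → l ∈ ls → (hub i , leaf i l) ∈ steps (hub i) (leafLoops i ls)
  ∈-leafLoops (here refl) = here refl
  ∈-leafLoops (there l∈)  = there (there (∈-leafLoops l∈))

  excursion : Fin n → List V
  excursion i = hub i ∷ leafLoops i (allFin (s i ∸ 1)) ++ root ∷ []

  excursion-walk : ∀ i → Walk root root (excursion i)
  excursion-walk i with walk-++ _ (root ∷ []) (leafLoops-walk i (allFin (s i ∸ 1))) ((rootEdge i , inj₂ refl) ∷ [] , refl)
  ... | adj , end = (rootEdge i , inj₁ refl) ∷ adj , end

  length-excursion : ∀ i → 1 ≤ s i → length (excursion i) ≡ 2 * s i
  length-excursion i 1≤sᵢ = begin
    suc (length (leafLoops i (allFin m) ++ root ∷ [])) ≡⟨ cong suc (length-++ (leafLoops i (allFin m))) ⟩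
    suc (length (leafLoops i (allFin m)) + 1)          ≡⟨ cong (λ ℓ → suc (ℓ + 1)) (length-leafLoops i (allFin m)) ⟩
    suc (2 * length (allFin m) + 1)                    ≡⟨ cong (λ ℓ → suc (2 * ℓ + 1)) (length-tabulate {n = m} id) ⟩
    suc (2 * m + 1)                                    ≡⟨ cong suc (+-comm (2 * m) 1) ⟩
    2 + 2 * m                                          ≡⟨ *-suc 2 m ⟨
    2 * suc m                                          ≡⟨ cong (2 *_) (m+[n∸m]≡n 1≤sᵢ) ⟩
    2 * s i                                            ∎
    where
    open ≡-Reasoning
    m = s i ∸ 1

  ∈-excursion-leaf : ∀ {i l} → (hub i , leaf i l) ∈ steps root (excursion i)
  ∈-excursion-leaf {i} {l} =
    there (∈-steps-++ˡ (leafLoops i (allFin (s i ∸ 1))) (root ∷ [])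
            (proj₂ (leafLoops-walk i (allFin (s i ∸ 1)))) (∈-leafLoops (∈-allFin l)))

  excursions : List (Fin n) → List V
  excursions = concatMap excursion

  excursions-walk : ∀ is → Walk root root (excursions is)
  excursions-walk []       = [] , refl
  excursions-walk (i ∷ is) = walk-++ (excursion i) (excursions is) (excursion-walk i) (excursions-walk is)

  length-excursions : (∀ i → 1 ≤ s i) → ∀ is → length (excursions is) ≡ 2 * sum (map s is)
  length-excursions s≥1 []       = refl
  length-excursions s≥1 (i ∷ is) = begin
    length (excursion i ++ excursions is)          ≡⟨ length-++ (excursion i) ⟩
    length (excursion i) + length (excursions is)  ≡⟨ cong₂ _+_ (length-excursion i (s≥1 i)) (length-excursions s≥1 is) ⟩
    2 * s i + 2 * sum (map s is)                   ≡⟨ *-distribˡ-+ 2 (s i) _ ⟨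
    2 * sum (map s (i ∷ is))                       ∎
    where open ≡-Reasoning

  ∈-excursions : ∀ {i is p} → i ∈ is → p ∈ steps root (excursion i) → p ∈ steps root (excursions is)
  ∈-excursions {i} {_ ∷ is} (here refl) p∈ =
    ∈-steps-++ˡ (excursion i) (excursions is) (proj₂ (excursion-walk i)) p∈
  ∈-excursions {_} {i ∷ is} (there i∈) p∈ =
    ∈-steps-++ʳ (excursion i) (excursions is) (proj₂ (excursion-walk i)) (∈-excursions i∈ p∈)

packing⇒cover : ∀ {n s B k} → (∀ i → 1 ≤ s i) → ExactBinPackingYes n s B k → CGEYes n s k (2 * B)
packing⇒cover {n} {s} {B} {k} s≥1 (bin , full) = cycle , (λ j → excursions-walk (items j)) , short , cover
  where
  items : Fin k → List (Fin n)
  items j = filter (λ i → bin i ≟ j) (allFin n)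

  cycle : Fin k → List (Vtx n s)
  cycle j = excursions (items j)

  short : ∀ j → cycleLength (cycle j) ≤ 2 * B
  short j = ≤-reflexive (trans (length-excursions s≥1 (items j)) (cong (2 *_) (full j)))

  ∈-items : ∀ i → i ∈ items (bin i)
  ∈-items i = ∈-filter⁺ (λ i' → bin i' ≟ bin i) (∈-allFin i) refl

  cover : ∀ e → ∃ λ j → EdgeInCycle e (cycle j)
  cover (rootEdge i)   = bin i , _ , ∈-excursions (∈-items i) (here refl) , inj₁ refl
  cover (leafEdge i l) = bin i , _ , ∈-excursions (∈-items i) ∈-excursion-leaf , inj₁ refl

module CoverToPacking {n : ℕ} {s : Fin n → ℕ} {B k : ℕ}
  (s≥1 : ∀ i → 1 ≤ s i) (total : totalSize n s ≡ B * k)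
  (C : Fin k → List (Vtx n s))
  (closed : ∀ j → IsRobotCycle (C j))
  (short : ∀ j → cycleLength (C j) ≤ 2 * B)
  (cover : ∀ e → ∃ λ j → EdgeInCycle e (C j)) where

  bin : Fin n → Fin k
  bin i = proj₁ (cover (rootEdge i))

  visits : Fin k → Fin n → ℕ
  visits j i = hubVisits i (C j)

  touched : Fin k → Fin n → ℕ
  touched j i = 1 ⊓ visits j i

  charged : Fin k → Fin n → ℕ
  charged j i = ∑[ l < s i ∸ 1 ] when (proj₁ (cover (leafEdge i l)) ≟ j) 1

  weight : Fin k → Fin n → ℕ
  weight j i = charged j i + touched j i

  ∑B≡∑s : ∑[ j < k ] B ≡ ∑ s
  ∑B≡∑s = trans (∑-const k B) (trans (*-comm k B) (trans (sym total) (totalSize≡∑ n s)))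

  charged≤leafVisits : ∀ j i → charged j i ≤ leafVisits i (C j)
  charged≤leafVisits j i =
    ≤-trans (∑-mono-≤ charged≤occurrences) (≤-reflexive (∑occurrences≡leafVisits i (C j)))
    where
    charged≤occurrences : ∀ l → when (proj₁ (cover (leafEdge i l)) ≟ j) 1 ≤ occurrences i l (C j)
    charged≤occurrences l with cover (leafEdge i l)
    ... | j' , e∈ with j' ≟ j
    ...   | yes refl = leaf∈⇒1≤occurrences {vs = C j} (far-end∈ {e = leafEdge i l} e∈)
    ...   | no _     = z≤n

  weight≤visits : ∀ j i → weight j i ≤ visits j i
  weight≤visits j i =
    ≤-trans (+-monoˡ-≤ (touched j i) (charged≤leafVisits j i)) (leafVisits+touched≤hubVisits i (closed j))

  ∑weight≤B : ∀ j → ∑[ i < n ] weight j i ≤ B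
  ∑weight≤B j = ≤-trans (∑-mono-≤ (weight≤visits j))
    (*-cancelˡ-≤ 2 (≤-trans (2*∑hubVisits≤length (closed j)) (short j)))

  ∑charged≡ : ∀ i → ∑[ j < k ] charged j i ≡ s i ∸ 1
  ∑charged≡ i = begin
    ∑[ j < k ] charged j i                                           ≡⟨ ∑-comm (λ l j → when (proj₁ (cover (leafEdge i l)) ≟ j) 1) ⟨
    ∑[ l < s i ∸ 1 ] ∑[ j < k ] when (proj₁ (cover (leafEdge i l)) ≟ j) 1 ≡⟨ sum-cong-≗ (λ l → ∑-when-≟ (proj₁ (cover (leafEdge i l))) 1) ⟩
    ∑[ l < s i ∸ 1 ] 1                                               ≡⟨ ∑-const (s i ∸ 1) 1 ⟩
    (s i ∸ 1) * 1                                                    ≡⟨ *-identityʳ _ ⟩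
    s i ∸ 1                                                          ∎
    where open ≡-Reasoning

  touched-at-bin : ∀ i → touched (bin i) i ≡ 1
  touched-at-bin i = m≤n⇒m⊓n≡m (hub∈⇒1≤hubVisits {vs = C (bin i)} (far-end∈ {e = rootEdge i} (proj₂ (cover (rootEdge i)))))

  s≤∑weight : ∀ i → s i ≤ ∑[ j < k ] weight j i
  s≤∑weight i = begin
    s i                                              ≡⟨ m∸n+n≡m (s≥1 i) ⟨
    s i ∸ 1 + 1                                      ≡⟨ cong₂ _+_ (∑charged≡ i) (touched-at-bin i) ⟨
    ∑[ j < k ] charged j i + touched (bin i) i       ≤⟨ +-monoʳ-≤ _ (≤-∑ (λ j → touched j i) (bin i)) ⟩
    ∑[ j < k ] charged j i + ∑[ j < k ] touched j i  ≡⟨ ∑-distrib-+ (λ j → charged j i) (λ j → touched j i) ⟨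
    ∑[ j < k ] weight j i                            ∎
    where open ≤-Reasoning

  ∑weight≡s : ∀ i → ∑[ j < k ] weight j i ≡ s i
  ∑weight≡s i = sym (∑-tight s≤∑weight ∑∑weight≤∑s i)
    where
    ∑∑weight≤∑s : ∑[ i < n ] ∑[ j < k ] weight j i ≤ ∑ s
    ∑∑weight≤∑s = begin
      ∑[ i < n ] ∑[ j < k ] weight j i ≡⟨ ∑-comm (λ i j → weight j i) ⟩
      ∑[ j < k ] ∑[ i < n ] weight j i ≤⟨ ∑-mono-≤ ∑weight≤B ⟩
      ∑[ j < k ] B                     ≡⟨ ∑B≡∑s ⟩
      ∑ s                              ∎
      where open ≤-Reasoning

  touched≡ : ∀ i j → touched j i ≡ when (bin i ≟ j) 1
  touched≡ i = sym ∘ ∑-tight atBin≤touched ∑touched≤1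
    where
    atBin≤touched : ∀ j → when (bin i ≟ j) 1 ≤ touched j i
    atBin≤touched j with bin i ≟ j
    ... | yes refl = ≤-reflexive (sym (touched-at-bin i))
    ... | no _     = z≤n

    ∑touched≤1 : ∑[ j < k ] touched j i ≤ ∑[ j < k ] when (bin i ≟ j) 1
    ∑touched≤1 = ≤-reflexive (trans (+-cancelˡ-≡ (s i ∸ 1) _ _ (begin
      s i ∸ 1 + ∑[ j < k ] touched j i                 ≡⟨ cong (_+ ∑[ j < k ] touched j i) (∑charged≡ i) ⟨
      ∑[ j < k ] charged j i + ∑[ j < k ] touched j i  ≡⟨ ∑-distrib-+ (λ j → charged j i) (λ j → touched j i) ⟨
      ∑[ j < k ] weight j i                            ≡⟨ ∑weight≡s i ⟩
      s i                                              ≡⟨ m∸n+n≡m (s≥1 i) ⟨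
      s i ∸ 1 + 1                                      ∎)) (sym (∑-when-≟ (bin i) 1)))
      where open ≡-Reasoning

  weight-off-bin : ∀ {i j} → j ≢ bin i → weight j i ≡ 0
  weight-off-bin {i} {j} j≢bin = n≤0⇒n≡0 (≤-trans (weight≤visits j i) (≤-reflexive (untouched⇒unvisited untouched)))
    where
    untouched : 1 ⊓ visits j i ≡ 0
    untouched = trans (touched≡ i j) (when-fails (bin i ≟ j) (j≢bin ∘ sym))

    untouched⇒unvisited : ∀ {m} → 1 ⊓ m ≡ 0 → m ≡ 0
    untouched⇒unvisited {zero} _ = refl

  weight≡ : ∀ j i → weight j i ≡ when (bin i ≟ j) (s i)
  weight≡ j i with bin i ≟ j
  ... | yes refl = trans (sym (∑-single (λ j → weight j i) (bin i) (λ _ → weight-off-bin))) (∑weight≡s i)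
  ... | no bin≢j = weight-off-bin (bin≢j ∘ sym)

  load≤B : ∀ j → binLoad s bin j ≤ B
  load≤B j = begin
    binLoad s bin j                      ≡⟨ binLoad≡∑ s bin j ⟩
    ∑[ i < n ] when (bin i ≟ j) (s i)    ≡⟨ sum-cong-≗ (weight≡ j) ⟨
    ∑[ i < n ] weight j i                ≤⟨ ∑weight≤B j ⟩
    B                                    ∎
    where open ≤-Reasoning

  ∑B≤∑load : ∑[ j < k ] B ≤ ∑[ j < k ] binLoad s bin j
  ∑B≤∑load = ≤-reflexive (begin
    ∑[ j < k ] B                                      ≡⟨ ∑B≡∑s ⟩
    ∑ s                                               ≡⟨ sum-cong-≗ (λ i → ∑-when-≟ (bin i) (s i)) ⟨
    ∑[ i < n ] ∑[ j < k ] when (bin i ≟ j) (s i)      ≡⟨ ∑-comm (λ i j → when (bin i ≟ j) (s i)) ⟩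
    ∑[ j < k ] ∑[ i < n ] when (bin i ≟ j) (s i)      ≡⟨ sum-cong-≗ (binLoad≡∑ s bin) ⟨
    ∑[ j < k ] binLoad s bin j                        ∎)
    where open ≡-Reasoning

  packing : ExactBinPackingYes n s B k
  packing = bin , ∑-tight load≤B ∑B≤∑load

mainTheorem9 : (n : ℕ) (s : Fin n → ℕ) (B k : ℕ) →
    (∀ i → 1 ≤ s i) → 1 ≤ B → 1 ≤ k →
    totalSize n s ≡ B * k →
    ExactBinPackingYes n s B k ⇔ CGEYes n s k (2 * B)
mainTheorem9 n s B k s≥1 _ _ total =
  mk⇔ (packing⇒cover s≥1)
      (λ (C , closed , short , cover) → CoverToPacking.packing s≥1 total C closed short cover)
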